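{- Let $G$ be a graph and $\{C_1,\dots,C_\ell\}$ a min-max clique covering of $G$ with simple intersection. If $S$ is a positive zero forcing set of $G$, then for all $i,j\in\{1,\dots,\ell\}$ the sets $(V(G)\setminus S)\cap C_{i,j}$ and $(V(G)\setminus S)\cap C_{i,i}$ have at most one element.
   Context: A clique is a set of vertices inducing a complete subgraph; maximal if no vertex can be added. A clique covering is a set of cliques such that every edge lies inside one of them; $\mathrm{cc}(G)$ is the minimum size of a clique covering; a min-max clique covering is one of size $\mathrm{cc}(G)$ all of whose cliques are maximal. A covering has simple intersection if no vertex lies in three distinct cliques of it. For $i\neq j$, $C_{i,j}=C_i\cap C_j$, and $C_{i,i}=C_i\setminus\bigcup_{j\neq i}C_j$. Positive zero forcing: a set $B$ of vertices is coloured black, the rest white; if $W_1,\dots,W_k$ are the vertex sets of the components of $G-B$ ($B$ the current black set), $u\in B$, and $w$ is the only white neighbour of $u$ in $G[W_i\cup B]$, then $w$ may be coloured black. $S$ is a positive zero forcing set if starting from $S$ black all vertices eventually become black. -}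

module Defs where

open import Data.Nat using (ℕ; _≤_)
open import Data.Fin using (Fin; _≟_)
open import Data.Fin.Subset using (Subset; _∈_; _∉_; _∪_; ⁅_⁆)
open import Data.Bool using (Bool; true; false)
open import Data.Product using (Σ; ∃; _×_)
open import Relation.Nullary using (¬_; yes; no)
open import Relation.Binary.PropositionalEquality using (_≡_; _≢_)

record Graph (n : ℕ) : Set where
  field
    adj    : Fin n → Fin n → Bool
    sym    : ∀ u v → adj u v ≡ adj v u
    irrefl : ∀ v → adj v v ≡ false
open Graph public

module _ {n : ℕ} (G : Graph n) where

  Adj : Fin n → Fin n → Set
  Adj u v = adj G u v ≡ true

  IsClique : Subset n → Set
  IsClique C = ∀ u v → u ∈ C → v ∈ C → u ≢ v → Adj u v

  IsMaximalClique : Subset n → Set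
  IsMaximalClique C = IsClique C × (∀ v → v ∉ C → ¬ IsClique (C ∪ ⁅ v ⁆))

  IsCliqueCovering : {ℓ : ℕ} → (Fin ℓ → Subset n) → Set
  IsCliqueCovering {ℓ} C =
    (∀ i → IsClique (C i)) ×
    (∀ u v → Adj u v → ∃ λ i → u ∈ C i × v ∈ C i)

  IsMinMaxCliqueCovering : {ℓ : ℕ} → (Fin ℓ → Subset n) → Set
  IsMinMaxCliqueCovering {ℓ} C =
    IsCliqueCovering C ×
    (∀ (m : ℕ) (D : Fin m → Subset n) → IsCliqueCovering D → ℓ ≤ m) ×
    (∀ i → IsMaximalClique (C i))

  data WhiteConn (B : Subset n) : Fin n → Fin n → Set where
    here : ∀ {x} → x ∉ B → WhiteConn B x x
    step : ∀ {x y z} → WhiteConn B x y → Adj y z → z ∉ B → WhiteConn B x z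

  -- positive zero forcing rule: some black u has w as its only white
  -- neighbour in G[W ∪ B], W the component of G - B containing w
  CanForce : Subset n → Fin n → Set
  CanForce B w = w ∉ B × ∃ λ u → u ∈ B × Adj u w ×
    (∀ x → WhiteConn B w x → Adj u x → x ≡ w)

  AllBlack : Subset n → Set
  AllBlack B = ∀ v → v ∈ B

  data Forces : Subset n → Set where
    done  : ∀ {B} → AllBlack B → Forces B
    force : ∀ {B} w → CanForce B w → Forces (B ∪ ⁅ w ⁆) → Forces B

  IsPositiveZeroForcingSet : Subset n → Set
  IsPositiveZeroForcingSet S = Forces S

HasSimpleIntersection : {n ℓ : ℕ} → (Fin ℓ → Subset n) → Set
HasSimpleIntersection {n} {ℓ} C =
  ∀ (v : Fin n) (i j k : Fin ℓ) → i ≢ j → j ≢ k → i ≢ k →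
  v ∈ C i → v ∈ C j → v ∈ C k → Data.Empty.⊥
  where import Data.Empty

InCij : {n ℓ : ℕ} → (Fin ℓ → Subset n) → Fin ℓ → Fin ℓ → Fin n → Set
InCij C i j v with i ≟ j
... | yes _ = v ∈ C i × (∀ k → k ≢ i → v ∉ C k)
... | no  _ = v ∈ C i × v ∈ C j

AtMostOne : {n : ℕ} → (Fin n → Set) → Set
AtMostOne P = ∀ u v → P u → P v → u ≡ v

-- Two distinct vertices u, v of the same cell C_{i,j} (or C_{i,i}) lie in exactly the same
-- cliques of the covering: a clique of a vertex of C_{i,j} is C_i or C_j by simple
-- intersection, and a vertex of C_{i,i} lies in C_i only. Since every edge is covered,
-- u and v are then adjacent closed twins, N[u] = N[v]. Closed twins can never both be
-- white before a positive zero forcing step: whichever black vertex x would force u is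
-- also adjacent to v, which lies in the same white component as u, so u is not the only
-- white neighbour of x there.
module Submission where

open import Defs hiding (sym)
open import Data.Nat using (ℕ)
open import Data.Fin using (Fin; _≟_)
open import Data.Fin.Subset using (Subset; _∈_; _∉_; _∪_; ⁅_⁆)
open import Data.Fin.Subset.Properties using (x∈p∪q⁻; x∈⁅y⁆⇒x≡y)
open import Data.Product using (_×_; _,_; proj₁; proj₂)
open import Data.Sum using (inj₁; inj₂)
open import Data.Empty using (⊥-elim)
open import Relation.Nullary using (¬_; yes; no)
open import Relation.Binary.PropositionalEquality
  using (_≡_; _≢_; refl; sym; trans; subst)

module _ {n : ℕ} (G : Graph n) where

  Adj-sym : ∀ {u v} → Adj G u v → Adj G v u
  Adj-sym {u} {v} a = trans (Graph.sym G v u) a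

  Adj⇒≢ : ∀ {u v} → Adj G u v → u ≢ v
  Adj⇒≢ {u} a refl with trans (sym a) (irrefl G u)
  ... | ()

  ClosedTwins : Fin n → Fin n → Set
  ClosedTwins u v =
    Adj G u v × (∀ x → Adj G u x → x ≢ v → Adj G v x)
              × (∀ x → Adj G v x → x ≢ u → Adj G u x)

  ClosedTwins-sym : ∀ {u v} → ClosedTwins u v → ClosedTwins v u
  ClosedTwins-sym (a , u⇒v , v⇒u) = Adj-sym a , v⇒u , u⇒v

  ∉-∪-⁅⁆ : ∀ {B : Subset n} {w x} → x ∉ B → x ≢ w → x ∉ B ∪ ⁅ w ⁆
  ∉-∪-⁅⁆ {B} {w} x∉B x≢w x∈B∪w with x∈p∪q⁻ B ⁅ w ⁆ x∈B∪w
  ... | inj₁ x∈B = x∉B x∈B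
  ... | inj₂ x∈w = x≢w (x∈⁅y⁆⇒x≡y w x∈w)

  closedTwin-cannotBeForced : ∀ {u v B} → ClosedTwins u v → v ∉ B → ¬ CanForce G B u
  closedTwin-cannotBeForced {u} {v} {B} (uv , u⇒v , _) v∉B (u∉B , x , x∈B , xu , onlyWhite) =
    Adj⇒≢ uv (sym (onlyWhite v v∼u xv))
    where
    v∼u : WhiteConn G B u v
    v∼u = step (here u∉B) uv v∉B

    xv : Adj G x v
    xv = Adj-sym (u⇒v x (Adj-sym xu) (λ x≡v → v∉B (subst (_∈ B) x≡v x∈B)))

  closedTwins-notBothWhite : ∀ {u v B} → ClosedTwins u v → u ∉ B → v ∉ B → ¬ Forces G B
  closedTwins-notBothWhite t u∉B v∉B (done allBlack) = u∉B (allBlack _)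
  closedTwins-notBothWhite {u} {v} t u∉B v∉B (force w canForce rest) with w ≟ u | w ≟ v
  ... | yes refl | _ = closedTwin-cannotBeForced t v∉B canForce
  ... | no _ | yes refl = closedTwin-cannotBeForced (ClosedTwins-sym t) u∉B canForce
  ... | no w≢u | no w≢v =
    closedTwins-notBothWhite t (∉-∪-⁅⁆ u∉B (λ u≡w → w≢u (sym u≡w)))
                               (∉-∪-⁅⁆ v∉B (λ v≡w → w≢v (sym v≡w))) rest

sameCliques⇒closedTwins : ∀ {n ℓ} (G : Graph n) (C : Fin ℓ → Subset n) → IsCliqueCovering G C →
  ∀ {u v i} → u ∈ C i → v ∈ C i → u ≢ v →
  (∀ k → u ∈ C k → v ∈ C k) → (∀ k → v ∈ C k → u ∈ C k) → ClosedTwins G u v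
sameCliques⇒closedTwins G C cov {u} {v} {i} u∈Cᵢ v∈Cᵢ u≢v u⊑v v⊑u =
  proj₁ cov i u v u∈Cᵢ v∈Cᵢ u≢v , nbhd u⊑v , nbhd v⊑u
  where
  nbhd : ∀ {a b} → (∀ k → a ∈ C k → b ∈ C k) → ∀ x → Adj G a x → x ≢ b → Adj G b x
  nbhd {a} {b} a⊑b x ax x≢b with proj₂ cov a x ax
  ... | k , a∈Cₖ , x∈Cₖ = proj₁ cov k b x (a⊑b k a∈Cₖ) x∈Cₖ (λ b≡x → x≢b (sym b≡x))

InCij⇒∈Cᵢ : ∀ {n ℓ} (C : Fin ℓ → Subset n) i j {v} → InCij C i j v → v ∈ C i
InCij⇒∈Cᵢ C i j p with i ≟ j
... | yes _ = proj₁ p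
... | no _  = proj₁ p

InCij-sameCliques : ∀ {n ℓ} (C : Fin ℓ → Subset n) → HasSimpleIntersection C →
  ∀ i j {u v} → InCij C i j u → InCij C i j v → ∀ k → u ∈ C k → v ∈ C k
InCij-sameCliques C simple i j {u} pu pv k u∈Cₖ with i ≟ j
... | yes _ with k ≟ i
...   | yes refl = proj₁ pv
...   | no k≢i   = ⊥-elim (proj₂ pu k k≢i u∈Cₖ)
InCij-sameCliques C simple i j {u} (u∈Cᵢ , u∈Cⱼ) (v∈Cᵢ , v∈Cⱼ) k u∈Cₖ | no i≢j with k ≟ i | k ≟ j
... | yes refl | _        = v∈Cᵢ
... | no _     | yes refl = v∈Cⱼ
... | no k≢i   | no k≢j   =
  ⊥-elim (simple u i j k i≢j (λ j≡k → k≢j (sym j≡k)) (λ i≡k → k≢i (sym i≡k)) u∈Cᵢ u∈Cⱼ u∈Cₖ)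

cell-atMostOneWhite : ∀ {n ℓ} (G : Graph n) (C : Fin ℓ → Subset n) →
  IsCliqueCovering G C → HasSimpleIntersection C →
  ∀ S → IsPositiveZeroForcingSet G S → ∀ i j → AtMostOne (λ v → v ∉ S × InCij C i j v)
cell-atMostOneWhite G C cov simple S forces i j u v (u∉S , pu) (v∉S , pv) with u ≟ v
... | yes u≡v = u≡v
... | no u≢v  = ⊥-elim (closedTwins-notBothWhite G twins u∉S v∉S forces)
  where
  twins : ClosedTwins G u v
  twins = sameCliques⇒closedTwins G C cov (InCij⇒∈Cᵢ C i j pu) (InCij⇒∈Cᵢ C i j pv) u≢v
            (InCij-sameCliques C simple i j pu pv) (InCij-sameCliques C simple i j pv pu)

lemma7p3 : (n : ℕ) (G : Graph n) (ℓ : ℕ) (C : Fin ℓ → Subset n) →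
    IsMinMaxCliqueCovering G C → HasSimpleIntersection C →
    (S : Subset n) → IsPositiveZeroForcingSet G S →
    (i j : Fin ℓ) →
      AtMostOne (λ v → v ∉ S × InCij C i j v) × AtMostOne (λ v → v ∉ S × InCij C i i v)
lemma7p3 n G ℓ C (cov , _) simple S forces i j =
  cell-atMostOneWhite G C cov simple S forces i j , cell-atMostOneWhite G C cov simple S forces i i
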